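{- Let $p$ be a prime, $d,k$ positive integers, $\mathbf N^{(1)},\dots,\mathbf N^{(k)}\in\mathbb{Z}^d$ with $\mathbf N^{(j)}\ge\mathbf 0$. Let $s\ge0$ be an integer and $\mathbf v,\mathbf u,\mathbf n\in\mathbb{Z}^d$ with $\mathbf v,\mathbf u,\mathbf n\ge\mathbf 0$, $0\le v_i<p$ and $0\le u_i<p^s$ for $i=1,\dots,d$. Then $$\frac{B_{\mathbf N}(\mathbf v+p\mathbf u+p^{s+1}\mathbf n)}{B_{\mathbf N}(p\mathbf u+p^{s+1}\mathbf n)}-\frac{B_{\mathbf N}(\mathbf v+p\mathbf u)}{B_{\mathbf N}(p\mathbf u)}\in p^{s+1}\mathbb{Z}_p.$$
   Context: For $\mathbf P,\mathbf m\in\mathbb{Z}^d$ with $\mathbf P,\mathbf m\ge\mathbf 0$, $B(\mathbf P,\mathbf m)=\big(\sum_{i=1}^dP_im_i\big)!\big/\prod_{i=1}^dm_i!^{P_i}$, and $B_{\mathbf N}(\mathbf m)=\prod_{j=1}^kB(\mathbf N^{(j)},\mathbf m)$. Vector inequalities are componentwise. $\mathbb{Z}_p$ denotes the $p$-adic integers. -}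

module Defs where

open import Data.Nat as ℕ using (ℕ; zero; suc; _!; _^_)
open import Data.Nat.Divisibility using (_∣_)
open import Data.Integer as ℤ using (+_; ∣_∣)
open import Data.Fin using (Fin; zero; suc)
open import Data.Rational as ℚ using (ℚ; 0ℚ; 1ℚ; _÷_; ↥_; ↧ₙ_; ≢-nonZero)
open import Data.Rational.Properties using (_≟_)
open import Data.Product using (_×_)
open import Relation.Nullary using (¬_; yes; no)

ℕ→ℚ : ℕ → ℚ
ℕ→ℚ n = (+ n) ℚ./ 1

sumF : ∀ {n} → (Fin n → ℕ) → ℕ
sumF {zero}  f = 0
sumF {suc n} f = f zero ℕ.+ sumF (λ i → f (suc i))

prodQ : ∀ {n} → (Fin n → ℚ) → ℚ
prodQ {zero}  f = 1ℚ
prodQ {suc n} f = f zero ℚ.* prodQ (λ i → f (suc i))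

-- total division on ℚ (x // 0 = 0); only ever applied to nonzero divisors here
_//_ : ℚ → ℚ → ℚ
x // y with y ≟ 0ℚ
... | yes _  = 0ℚ
... | no y≢0 = _÷_ x y {{≢-nonZero y≢0}}

B : ∀ {d} → (Fin d → ℕ) → (Fin d → ℕ) → ℚ
B P m = ℕ→ℚ (sumF (λ i → P i ℕ.* m i) !) // prodQ (λ i → ℕ→ℚ ((m i !) ^ P i))

BN : ∀ {k d} → (Fin k → Fin d → ℕ) → (Fin d → ℕ) → ℚ
BN N m = prodQ (λ j → B (N j) m)

-- x ∈ p^e ℤ_p for a rational x: in lowest terms, p^e divides the numerator
-- and p does not divide the denominator.
InPowZp : ℕ → ℕ → ℚ → Set
InPowZp p e x = ((p ^ e) ∣ ∣ ↥ x ∣) × ¬ (p ∣ ↧ₙ x)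

module Submission where

-- The quotient B_N(v + m) / B_N(m) is a fraction of two integer
-- polynomials in m: the numerator is ∏ⱼ (Lⱼ m + 1)⋯(Lⱼ m + Lⱼ v) with Lⱼ m = Σᵢ N⁽ʲ⁾ᵢ mᵢ,
-- the denominator ∏ⱼ ∏ᵢ ((mᵢ + 1)⋯(mᵢ + vᵢ))^N⁽ʲ⁾ᵢ.  Both are therefore determined by m
-- modulo p^(s+1), and pu + p^(s+1)n ≡ pu.  Since p ∣ mᵢ and vᵢ < p, no factor mᵢ + t with
-- 1 ≤ t ≤ vᵢ is divisible by p, so the denominators are p-adic units, and
-- a/b − a′/b′ = (ab′ − a′b)/(bb′) with ab′ ≡ a′b modulo p^(s+1).

open import Defs
open import Data.Nat using (ℕ; suc; _+_; _*_; _^_; _<_; _≤_)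
open import Data.Nat.Primality using (Prime)
open import Data.Fin using (Fin)
open import Data.Rational using (_-_)

open import Data.Fin using (zero; suc)
open import Data.Integer as ℤ using (+_)
import Data.Integer.Properties as ℤP
open import Data.Integer.Tactic.RingSolver using (solve-∀)
open import Data.Nat as ℕ using (zero; _!; NonZero)
open import Data.Nat.Divisibility
open import Data.Nat.DivMod using (_%_; %-distribˡ-+; %-distribˡ-*; %-remove-+ʳ; m≡m%n+[m/n]*n)
open import Data.Nat.GCD using (gcd; gcd[m,n]∣n)
open import Data.Nat.Primality using (euclidsLemma; ¬prime[1]; prime⇒nonZero)
import Data.Nat.Properties as ℕP
open import Data.Nat.Properties using (_!≢0)
open import Data.Product using (_,_)
open import Data.Rational as ℚ using (ℚ; _/_; 0ℚ; toℚᵘ; fromℚᵘ; ↥_; ↧ₙ_)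
import Data.Rational.Properties as ℚP
import Data.Rational.Unnormalised as ℚᵘ
import Data.Rational.Unnormalised.Properties as ℚᵘP
open import Data.Sum using (inj₁; inj₂)
open import Function using (_∘_)
open import Relation.Binary.PropositionalEquality
open import Relation.Nullary using (yes; no; contradiction)

open import Algebra.Properties.CommutativeSemigroup ℕP.*-commutativeSemigroup
  using (x∙yz≈y∙xz; xy∙z≈xz∙y)
open import Algebra.Properties.CommutativeMonoid.Sum ℕP.+-0-commutativeMonoid
  using (∑-distrib-+; sum-cong-≗) renaming (sum to ∑)
open import Algebra.Properties.CommutativeMonoid.Sum ℕP.*-1-commutativeMonoid
  using () renaming (sum to ∏; ∑-distrib-+ to ∏-distrib-*; sum-cong-≗ to ∏-cong-≗;
                     sum-replicate-zero to ∏-replicate-1)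

private variable
  n d k : ℕ

sumF≡∑ : (f : Fin n → ℕ) → sumF f ≡ ∑ f
sumF≡∑ {zero}  f = refl
sumF≡∑ {suc n} f = cong (_+_ (f zero)) (sumF≡∑ (f ∘ suc))

∏-preserves : (P : ℕ → Set) → P 1 → (∀ {a b} → P a → P b → P (a * b)) →
              (f : Fin n → ℕ) → (∀ i → P (f i)) → P (∏ f)
∏-preserves {zero}  P P1 P* f Pf = P1
∏-preserves {suc n} P P1 P* f Pf = P* (Pf zero) (∏-preserves P P1 P* (f ∘ suc) (Pf ∘ suc))

∏-nonZero : (f : Fin n → ℕ) → (∀ i → NonZero (f i)) → NonZero (∏ f)
∏-nonZero = ∏-preserves NonZero _ (λ {a} {b} a≢0 b≢0 → ℕP.m*n≢0 a b {{a≢0}} {{b≢0}})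

[m*n]^o≡m^o*n^o : ∀ a b k → (a * b) ^ k ≡ a ^ k * b ^ k
[m*n]^o≡m^o*n^o a b zero    = refl
[m*n]^o≡m^o*n^o a b (suc k) =
  trans (cong (a * b *_) ([m*n]^o≡m^o*n^o a b k)) (ℕP.[m*n]*[o*p]≡[m*o]*[n*p] a b (a ^ k) (b ^ k))

rising : ℕ → ℕ → ℕ
rising x zero    = 1
rising x (suc M) = suc (x + M) * rising x M

[m+n]!≡m!*rising : ∀ x M → (x + M) ! ≡ x ! * rising x M
[m+n]!≡m!*rising x zero    = trans (cong _! (ℕP.+-identityʳ x)) (sym (ℕP.*-identityʳ (x !)))
[m+n]!≡m!*rising x (suc M) = begin
  (x + suc M) !                    ≡⟨ cong _! (ℕP.+-suc x M) ⟩
  suc (x + M) * (x + M) !          ≡⟨ cong (suc (x + M) *_) ([m+n]!≡m!*rising x M) ⟩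
  suc (x + M) * (x ! * rising x M) ≡⟨ x∙yz≈y∙xz (suc (x + M)) (x !) (rising x M) ⟩
  x ! * rising x (suc M)           ∎
  where open ≡-Reasoning

rising-nonZero : ∀ x M → NonZero (rising x M)
rising-nonZero x zero    = _
rising-nonZero x (suc M) = ℕP.m*n≢0 (suc (x + M)) (rising x M) {{_}} {{rising-nonZero x M}}

fromℚᵘ-homo-* : ∀ x y → fromℚᵘ (x ℚᵘ.* y) ≡ fromℚᵘ x ℚ.* fromℚᵘ y
fromℚᵘ-homo-* x y = ℚP.toℚᵘ-injective (begin
  toℚᵘ (fromℚᵘ (x ℚᵘ.* y))               ≈⟨ ℚP.toℚᵘ-fromℚᵘ (x ℚᵘ.* y) ⟩
  x ℚᵘ.* y                                ≈⟨ ℚᵘP.*-cong (ℚP.toℚᵘ-fromℚᵘ x) (ℚP.toℚᵘ-fromℚᵘ y) ⟨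
  toℚᵘ (fromℚᵘ x) ℚᵘ.* toℚᵘ (fromℚᵘ y)   ≈⟨ ℚP.toℚᵘ-homo-* (fromℚᵘ x) (fromℚᵘ y) ⟨
  toℚᵘ (fromℚᵘ x ℚ.* fromℚᵘ y)           ∎)
  where open ℚᵘP.≃-Reasoning

fromℚᵘ-homo-minus : ∀ x y → fromℚᵘ (x ℚᵘ.- y) ≡ fromℚᵘ x - fromℚᵘ y
fromℚᵘ-homo-minus x y = ℚP.toℚᵘ-injective (begin
  toℚᵘ (fromℚᵘ (x ℚᵘ.- y))                  ≈⟨ ℚP.toℚᵘ-fromℚᵘ (x ℚᵘ.- y) ⟩
  x ℚᵘ.- y                                   ≈⟨ ℚᵘP.+-cong (ℚP.toℚᵘ-fromℚᵘ x) (ℚᵘP.-‿cong (ℚP.toℚᵘ-fromℚᵘ y)) ⟨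
  toℚᵘ (fromℚᵘ x) ℚᵘ.- toℚᵘ (fromℚᵘ y)      ≈⟨ ℚᵘP.+-congʳ (toℚᵘ (fromℚᵘ x)) (ℚP.toℚᵘ-homo‿- (fromℚᵘ y)) ⟨
  toℚᵘ (fromℚᵘ x) ℚᵘ.+ toℚᵘ (ℚ.- fromℚᵘ y)  ≈⟨ ℚP.toℚᵘ-homo-+ (fromℚᵘ x) (ℚ.- fromℚᵘ y) ⟨
  toℚᵘ (fromℚᵘ x - fromℚᵘ y)                ∎)
  where open ℚᵘP.≃-Reasoning

-- For b = suc b′, a / b is definitionally fromℚᵘ (mkℚᵘ a b′), so these are ℚᵘ facts
-- transported along fromℚᵘ.

/-*-/ : ∀ a b c d .{{_ : NonZero b}} .{{_ : NonZero d}} →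
        (a / b) ℚ.* (c / d) ≡ ((a ℤ.* c) / (b * d)) {{ℕP.m*n≢0 b d}}
/-*-/ a (suc b) c (suc d) = sym (fromℚᵘ-homo-* (ℚᵘ.mkℚᵘ a b) (ℚᵘ.mkℚᵘ c d))

/-minus-/ : ∀ a b c d .{{_ : NonZero b}} .{{_ : NonZero d}} →
       (a / b) - (c / d) ≡ ((a ℤ.* + d ℤ.- c ℤ.* + b) / (b * d)) {{ℕP.m*n≢0 b d}}
/-minus-/ a (suc b) c (suc d) = trans (sym (fromℚᵘ-homo-minus (ℚᵘ.mkℚᵘ a b) (ℚᵘ.mkℚᵘ c d)))
  (cong (λ z → (a ℤ.* + suc d ℤ.+ z) / (suc b * suc d)) (sym (ℤP.neg-distribˡ-* c (+ suc b))))

*-cancelʳ-/ : ∀ a b c .{{_ : NonZero b}} .{{_ : NonZero c}} →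
              ((a ℤ.* + c) / (b * c)) {{ℕP.m*n≢0 b c}} ≡ a / b
*-cancelʳ-/ a (suc b) (suc c) = ℚP.fromℚᵘ-cong (ℚᵘP.*-cancelʳ-/ (suc c) {a} {suc b})

/-nonZero : ∀ a b .{{_ : NonZero a}} .{{_ : NonZero b}} → ℚ.NonZero (+ a / b)
/-nonZero a b = ℚP.pos⇒nonZero (+ a / b) {{ℚP.normalize-pos a b}}

//-unique : ∀ {x y z} .{{_ : ℚ.NonZero y}} → z ℚ.* y ≡ x → x // y ≡ z
//-unique {x} {y} {z} z*y≡x with y ℚP.≟ 0ℚ
... | yes refl = contradiction refl (ℕ.≢-nonZero⁻¹ 0)
... | no y≢0  = begin
  x ℚ.* y⁻¹          ≡⟨ cong (ℚ._* y⁻¹) z*y≡x ⟨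
  z ℚ.* y ℚ.* y⁻¹    ≡⟨ ℚP.*-assoc z y y⁻¹ ⟩
  z ℚ.* (y ℚ.* y⁻¹)  ≡⟨ cong (z ℚ.*_) (ℚP.*-inverseʳ y {{ℚ.≢-nonZero y≢0}}) ⟩
  z ℚ.* ℚ.1ℚ         ≡⟨ ℚP.*-identityʳ z ⟩
  z                  ∎
  where
  open ≡-Reasoning
  y⁻¹ : ℚ
  y⁻¹ = (ℚ.1/ y) {{ℚ.≢-nonZero y≢0}}

prodQ-/ : (x : Fin n → ℚ) (a b : Fin n → ℕ) (b≢0 : ∀ i → NonZero (b i)) →
          (∀ i → x i ≡ (+ a i / b i) {{b≢0 i}}) →
          prodQ x ≡ (+ ∏ a / ∏ b) {{∏-nonZero b b≢0}}
prodQ-/ {zero}  x a b b≢0 x≡a/b = refl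
prodQ-/ {suc n} x a b b≢0 x≡a/b = begin
  x zero ℚ.* prodQ (x ∘ suc)                           ≡⟨ cong₂ ℚ._*_ (x≡a/b zero) x′≡a′/b′ ⟩
  (+ a zero / b zero) ℚ.* (+ ∏ (a ∘ suc) / ∏ (b ∘ suc)) ≡⟨ /-*-/ (+ a zero) (b zero) (+ ∏ (a ∘ suc)) (∏ (b ∘ suc)) ⟩
  (+ a zero ℤ.* + ∏ (a ∘ suc)) / ∏ b                   ≡⟨ cong (_/ ∏ b) (ℤP.pos-* (a zero) (∏ (a ∘ suc))) ⟨
  + ∏ a / ∏ b                                          ∎
  where
  open ≡-Reasoning
  instance
    b₀≢0 : NonZero (b zero)
    b₀≢0 = b≢0 zero
    ∏b′≢0 : NonZero (∏ (b ∘ suc))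
    ∏b′≢0 = ∏-nonZero (b ∘ suc) (b≢0 ∘ suc)
    ∏b≢0 : NonZero (∏ b)
    ∏b≢0 = ∏-nonZero b b≢0
  x′≡a′/b′ : prodQ (x ∘ suc) ≡ + ∏ (a ∘ suc) / ∏ (b ∘ suc)
  x′≡a′/b′ = prodQ-/ (x ∘ suc) (a ∘ suc) (b ∘ suc) (b≢0 ∘ suc) (x≡a/b ∘ suc)

prodQ-ℕ→ℚ : (a : Fin n → ℕ) → prodQ (λ i → ℕ→ℚ (a i)) ≡ ℕ→ℚ (∏ a)
prodQ-ℕ→ℚ {n} a = trans (prodQ-/ (λ i → ℕ→ℚ (a i)) a (λ _ → 1) (λ _ → _) (λ _ → refl))
                        (ℚP./-cong {+ ∏ a} {{∏-nonZero {n} (λ _ → 1) (λ _ → _)}} refl (∏-replicate-1 n))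

ℕ→ℚ-// : ∀ a b .{{_ : NonZero b}} → ℕ→ℚ a // ℕ→ℚ b ≡ + a / b
ℕ→ℚ-// a b = //-unique {{/-nonZero b 1}} (begin
  (+ a / b) ℚ.* (+ b / 1)  ≡⟨ /-*-/ (+ a) b (+ b) 1 ⟩
  (+ a ℤ.* + b) / (b * 1)  ≡⟨ ℚP./-cong {+ a ℤ.* + b} refl (ℕP.*-comm b 1) ⟩
  (+ a ℤ.* + b) / (1 * b)  ≡⟨ *-cancelʳ-/ (+ a) 1 b ⟩
  + a / 1                  ∎)
  where
  open ≡-Reasoning
  instance
    b*1≢0 : NonZero (b * 1)
    b*1≢0 = ℕP.m*n≢0 b 1
    1*b≢0 : NonZero (1 * b)
    1*b≢0 = ℕP.m*n≢0 1 b

infix 9 _·_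

_·_ : (Fin d → ℕ) → (Fin d → ℕ) → ℕ
P · m = sumF (λ i → P i * m i)

·-distribʳ-+ : (P : Fin d → ℕ) {f v m : Fin d → ℕ} → (∀ i → f i ≡ v i + m i) →
               P · f ≡ P · v + P · m
·-distribʳ-+ P {f} {v} {m} f≡v+m = begin
  P · f                                      ≡⟨ sumF≡∑ (λ i → P i * f i) ⟩
  ∑ (λ i → P i * f i)                        ≡⟨ sum-cong-≗ P*f≗P*v+P*m ⟩
  ∑ (λ i → P i * v i + P i * m i)            ≡⟨ ∑-distrib-+ (λ i → P i * v i) (λ i → P i * m i) ⟩
  ∑ (λ i → P i * v i) + ∑ (λ i → P i * m i)  ≡⟨ cong₂ _+_ (sumF≡∑ (λ i → P i * v i)) (sumF≡∑ (λ i → P i * m i)) ⟨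
  P · v + P · m                              ∎
  where
  open ≡-Reasoning
  P*f≗P*v+P*m : ∀ i → P i * f i ≡ P i * v i + P i * m i
  P*f≗P*v+P*m i = trans (cong (P i *_) (f≡v+m i)) (ℕP.*-distribˡ-+ (P i) (v i) (m i))

facPow : (Fin d → ℕ) → (Fin d → ℕ) → ℕ
facPow P m = ∏ (λ i → (m i !) ^ P i)

facPow-nonZero : (P m : Fin d → ℕ) → NonZero (facPow P m)
facPow-nonZero P m = ∏-nonZero _ (λ i → ℕP.m^n≢0 (m i !) (P i) {{m i !≢0}})

B≡/ : (P m : Fin d → ℕ) → B P m ≡ (+ ((P · m) !) / facPow P m) {{facPow-nonZero P m}}
B≡/ P m = trans (cong (ℕ→ℚ ((P · m) !) //_) (prodQ-ℕ→ℚ (λ i → (m i !) ^ P i)))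
                (ℕ→ℚ-// ((P · m) !) (facPow P m) {{facPow-nonZero P m}})

risingPow : (Fin d → ℕ) → (Fin d → ℕ) → (Fin d → ℕ) → ℕ
risingPow P v m = ∏ (λ i → rising (m i) (v i) ^ P i)

facPow-split : (P : Fin d → ℕ) {f v m : Fin d → ℕ} → (∀ i → f i ≡ v i + m i) →
               facPow P f ≡ facPow P m * risingPow P v m
facPow-split P {f} {v} {m} f≡v+m =
  trans (∏-cong-≗ split) (∏-distrib-* (λ i → (m i !) ^ P i) (λ i → rising (m i) (v i) ^ P i))
  where
  split : ∀ i → (f i !) ^ P i ≡ (m i !) ^ P i * rising (m i) (v i) ^ P i
  split i = begin
    (f i !) ^ P i                            ≡⟨ cong (λ x → (x !) ^ P i) (trans (f≡v+m i) (ℕP.+-comm (v i) (m i))) ⟩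
    ((m i + v i) !) ^ P i                    ≡⟨ cong (_^ P i) ([m+n]!≡m!*rising (m i) (v i)) ⟩
    (m i ! * rising (m i) (v i)) ^ P i       ≡⟨ [m*n]^o≡m^o*n^o (m i !) (rising (m i) (v i)) (P i) ⟩
    (m i !) ^ P i * rising (m i) (v i) ^ P i ∎
    where open ≡-Reasoning

num : (Fin k → Fin d → ℕ) → (Fin d → ℕ) → ℕ
num N m = ∏ (λ j → (N j · m) !)

den : (Fin k → Fin d → ℕ) → (Fin d → ℕ) → ℕ
den N m = ∏ (λ j → facPow (N j) m)

den-nonZero : (N : Fin k → Fin d → ℕ) (m : Fin d → ℕ) → NonZero (den N m)
den-nonZero N m = ∏-nonZero _ (λ j → facPow-nonZero (N j) m)

BN≡/ : (N : Fin k → Fin d → ℕ) (m : Fin d → ℕ) → BN N m ≡ (+ num N m / den N m) {{den-nonZero N m}}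
BN≡/ N m = prodQ-/ (λ j → B (N j) m) _ _ (λ j → facPow-nonZero (N j) m) (λ j → B≡/ (N j) m)

quotNum : (Fin k → Fin d → ℕ) → (Fin d → ℕ) → (Fin d → ℕ) → ℕ
quotNum N v m = ∏ (λ j → rising (N j · m) (N j · v))

quotDen : (Fin k → Fin d → ℕ) → (Fin d → ℕ) → (Fin d → ℕ) → ℕ
quotDen N v m = ∏ (λ j → risingPow (N j) v m)

quotDen-nonZero : (N : Fin k → Fin d → ℕ) (v m : Fin d → ℕ) → NonZero (quotDen N v m)
quotDen-nonZero N v m =
  ∏-nonZero _ (λ j → ∏-nonZero _ (λ i → ℕP.m^n≢0 _ (N j i) {{rising-nonZero (m i) (v i)}}))

num-split : (N : Fin k → Fin d → ℕ) {f v m : Fin d → ℕ} → (∀ i → f i ≡ v i + m i) →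
            num N f ≡ num N m * quotNum N v m
num-split N {f} {v} {m} f≡v+m =
  trans (∏-cong-≗ split) (∏-distrib-* (λ j → (N j · m) !) (λ j → rising (N j · m) (N j · v)))
  where
  split : ∀ j → (N j · f) ! ≡ (N j · m) ! * rising (N j · m) (N j · v)
  split j = trans (cong _! (trans (·-distribʳ-+ (N j) f≡v+m) (ℕP.+-comm (N j · v) (N j · m))))
                  ([m+n]!≡m!*rising (N j · m) (N j · v))

den-split : (N : Fin k → Fin d → ℕ) {f v m : Fin d → ℕ} → (∀ i → f i ≡ v i + m i) →
            den N f ≡ den N m * quotDen N v m
den-split N {f} {v} {m} f≡v+m =
  trans (∏-cong-≗ (λ j → facPow-split (N j) {f} {v} {m} f≡v+m))
        (∏-distrib-* (λ j → facPow (N j) m) (λ j → risingPow (N j) v m))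

BN-quot : (N : Fin k → Fin d → ℕ) {f v m : Fin d → ℕ} → (∀ i → f i ≡ v i + m i) →
          BN N f // BN N m ≡ (+ quotNum N v m / quotDen N v m) {{quotDen-nonZero N v m}}
BN-quot N {f} {v} {m} f≡v+m = //-unique {{BN-nonZero}} (begin
  (+ Q / D) ℚ.* BN N m                 ≡⟨ ℚP.*-comm (+ Q / D) (BN N m) ⟩
  BN N m ℚ.* (+ Q / D)                 ≡⟨ cong (ℚ._* (+ Q / D)) (BN≡/ N m) ⟩
  (+ num N m / den N m) ℚ.* (+ Q / D)  ≡⟨ /-*-/ (+ num N m) (den N m) (+ Q) D ⟩
  (+ num N m ℤ.* + Q) / (den N m * D)  ≡⟨ ℚP./-cong (sym (ℤP.pos-* (num N m) Q)) refl ⟩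
  + (num N m * Q) / (den N m * D)      ≡⟨ ℚP./-cong (cong +_ (num-split N {f} {v} {m} f≡v+m))
                                                    (den-split N {f} {v} {m} f≡v+m) ⟨
  + num N f / den N f                  ≡⟨ BN≡/ N f ⟨
  BN N f                               ∎)
  where
  open ≡-Reasoning
  Q D : ℕ
  Q = quotNum N v m
  D = quotDen N v m
  instance
    D≢0 : NonZero D
    D≢0 = quotDen-nonZero N v m
    denₘ≢0 : NonZero (den N m)
    denₘ≢0 = den-nonZero N m
    den_f≢0 : NonZero (den N f)
    den_f≢0 = den-nonZero N f
    den*D≢0 : NonZero (den N m * D)
    den*D≢0 = ℕP.m*n≢0 (den N m) D
  BN-nonZero : ℚ.NonZero (BN N m)
  BN-nonZero = subst ℚ.NonZero (sym (BN≡/ N m))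
    (/-nonZero (num N m) (den N m) {{∏-nonZero (λ j → (N j · m) !) (λ j → (N j · m) !≢0)}})

module Mod (q : ℕ) .{{_ : NonZero q}} where

  infix 4 _≈_
  _≈_ : ℕ → ℕ → Set
  a ≈ b = a % q ≡ b % q

  +-cong : ∀ {a b c d} → a ≈ c → b ≈ d → a + b ≈ c + d
  +-cong {a} {b} {c} {d} a≈c b≈d = begin
    (a + b) % q          ≡⟨ %-distribˡ-+ a b q ⟩
    (a % q + b % q) % q  ≡⟨ cong₂ (λ x y → (x + y) % q) a≈c b≈d ⟩
    (c % q + d % q) % q  ≡⟨ %-distribˡ-+ c d q ⟨
    (c + d) % q          ∎
    where open ≡-Reasoning

  *-cong : ∀ {a b c d} → a ≈ c → b ≈ d → a * b ≈ c * d
  *-cong {a} {b} {c} {d} a≈c b≈d = begin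
    (a * b) % q            ≡⟨ %-distribˡ-* a b q ⟩
    (a % q * (b % q)) % q  ≡⟨ cong₂ (λ x y → (x * y) % q) a≈c b≈d ⟩
    (c % q * (d % q)) % q  ≡⟨ %-distribˡ-* c d q ⟨
    (c * d) % q            ∎
    where open ≡-Reasoning

  ^-cong : ∀ {a b} k → a ≈ b → a ^ k ≈ b ^ k
  ^-cong zero    a≈b = refl
  ^-cong (suc k) a≈b = *-cong a≈b (^-cong k a≈b)

  sumF-cong : {f g : Fin n → ℕ} → (∀ i → f i ≈ g i) → sumF f ≈ sumF g
  sumF-cong {zero}  f≈g = refl
  sumF-cong {suc n} f≈g = +-cong (f≈g zero) (sumF-cong (f≈g ∘ suc))

  ∏-cong : {f g : Fin n → ℕ} → (∀ i → f i ≈ g i) → ∏ f ≈ ∏ g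
  ∏-cong {zero}  f≈g = refl
  ∏-cong {suc n} f≈g = *-cong (f≈g zero) (∏-cong (f≈g ∘ suc))

  rising-cong : ∀ {x y} M → x ≈ y → rising x M ≈ rising y M
  rising-cong zero            x≈y = refl
  rising-cong {x} {y} (suc M) x≈y =
    *-cong (+-cong {1} {x + M} {1} {y + M} refl (+-cong x≈y refl)) (rising-cong M x≈y)

  ·-cong : (P : Fin d → ℕ) {m m′ : Fin d → ℕ} → (∀ i → m i ≈ m′ i) → P · m ≈ P · m′
  ·-cong P m≈m′ = sumF-cong (λ i → *-cong {P i} refl (m≈m′ i))

  quotNum-cong : (N : Fin k → Fin d → ℕ) (v : Fin d → ℕ) {m m′ : Fin d → ℕ} →
                 (∀ i → m i ≈ m′ i) → quotNum N v m ≈ quotNum N v m′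
  quotNum-cong N v m≈m′ = ∏-cong (λ j → rising-cong (N j · v) (·-cong (N j) m≈m′))

  quotDen-cong : (N : Fin k → Fin d → ℕ) (v : Fin d → ℕ) {m m′ : Fin d → ℕ} →
                 (∀ i → m i ≈ m′ i) → quotDen N v m ≈ quotDen N v m′
  quotDen-cong N v m≈m′ = ∏-cong (λ j → ∏-cong (λ i → ^-cong (N j i) (rising-cong (v i) (m≈m′ i))))

  ≈⇒∣∣-∣ : ∀ {a b} → a ≈ b → q ∣ ℤ.∣ + a ℤ.- + b ∣
  ≈⇒∣∣-∣ {a} {b} a≈b =
    subst (q ∣_) (sym (trans (cong ℤ.∣_∣ a-b≡z*q) (ℤP.abs-* z (+ q)))) (n∣m*n ℤ.∣ z ∣)
    where
    r x y z : ℤ.ℤ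
    r = + (a % q)
    x = + (a ℕ./ q)
    y = + (b ℕ./ q)
    z = x ℤ.- y
    +≡%+/* : ∀ c → + c ≡ + (c % q) ℤ.+ + (c ℕ./ q) ℤ.* + q
    +≡%+/* c = begin
      + c                                ≡⟨ cong +_ (m≡m%n+[m/n]*n c q) ⟩
      + (c % q + c ℕ./ q * q)            ≡⟨ ℤP.pos-+ (c % q) (c ℕ./ q * q) ⟩
      + (c % q) ℤ.+ + (c ℕ./ q * q)      ≡⟨ cong (ℤ._+_ (+ (c % q))) (ℤP.pos-* (c ℕ./ q) q) ⟩
      + (c % q) ℤ.+ + (c ℕ./ q) ℤ.* + q  ∎
      where open ≡-Reasoning
    [r+xq]-[r+yq]≡[x-y]q : ∀ r x y q → (r ℤ.+ x ℤ.* q) ℤ.- (r ℤ.+ y ℤ.* q) ≡ (x ℤ.- y) ℤ.* q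
    [r+xq]-[r+yq]≡[x-y]q = solve-∀
    a-b≡z*q : + a ℤ.- + b ≡ z ℤ.* + q
    a-b≡z*q = begin
      + a ℤ.- + b                                        ≡⟨ cong₂ ℤ._-_ (+≡%+/* a) (+≡%+/* b) ⟩
      (r ℤ.+ x ℤ.* + q) ℤ.- (+ (b % q) ℤ.+ y ℤ.* + q)  ≡⟨ cong (λ t → (r ℤ.+ x ℤ.* + q) ℤ.- (+ t ℤ.+ y ℤ.* + q)) a≈b ⟨
      (r ℤ.+ x ℤ.* + q) ℤ.- (r ℤ.+ y ℤ.* + q)          ≡⟨ [r+xq]-[r+yq]≡[x-y]q r x y (+ q) ⟩
      z ℤ.* + q                                          ∎
      where open ≡-Reasoning

module _ {p : ℕ} (p-prime : Prime p) where

  private instance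
    p≢0 : NonZero p
    p≢0 = prime⇒nonZero p-prime

  p∤1 : p ∤ 1
  p∤1 p∣1 = ¬prime[1] (subst Prime (∣1⇒≡1 p∣1) p-prime)

  ∤-* : ∀ {a b} → p ∤ a → p ∤ b → p ∤ a * b
  ∤-* {a} {b} p∤a p∤b p∣ab with euclidsLemma a b p-prime p∣ab
  ... | inj₁ p∣a = p∤a p∣a
  ... | inj₂ p∣b = p∤b p∣b

  ∤-∏ : (f : Fin n → ℕ) → (∀ i → p ∤ f i) → p ∤ ∏ f
  ∤-∏ = ∏-preserves (p ∤_) p∤1 ∤-*

  ∤-^ : ∀ {a} k → p ∤ a → p ∤ a ^ k
  ∤-^ zero    p∤a = p∤1
  ∤-^ (suc k) p∤a = ∤-* p∤a (∤-^ k p∤a)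

  ∤-rising : ∀ {x} M → p ∣ x → M < p → p ∤ rising x M
  ∤-rising         zero    p∣x M<p = p∤1
  ∤-rising {x} (suc M) p∣x M<p = ∤-* p∤1+x+M (∤-rising M p∣x (ℕP.<-trans (ℕP.n<1+n M) M<p))
    where
    p∤1+x+M : p ∤ suc (x + M)
    p∤1+x+M p∣1+x+M = >⇒∤ M<p (∣m+n∣m⇒∣n (subst (p ∣_) (sym (ℕP.+-suc x M)) p∣1+x+M) p∣x)

  ∤-quotDen : (N : Fin k → Fin d → ℕ) (v m : Fin d → ℕ) →
              (∀ i → p ∣ m i) → (∀ i → v i < p) → p ∤ quotDen N v m
  ∤-quotDen N v m p∣m v<p = ∤-∏ _ (λ j → ∤-∏ _ (λ i → ∤-^ (N j i) (∤-rising (v i) (p∣m i) (v<p i))))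

  p^k∣m*n⇒p^k∣m : ∀ k {m n} → p ∤ n → p ^ k ∣ m * n → p ^ k ∣ m
  p^k∣m*n⇒p^k∣m zero    {m}     p∤n _ = 1∣ m
  p^k∣m*n⇒p^k∣m (suc k) {m} {n} p∤n p^[1+k]∣mn
    with euclidsLemma m n p-prime (∣-trans (m∣m*n (p ^ k)) p^[1+k]∣mn)
  ... | inj₂ p∣n = contradiction p∣n p∤n
  ... | inj₁ (divides m′ refl) =
    subst (_∣ m′ * p) (ℕP.*-comm (p ^ k) p) (*-monoˡ-∣ {p ^ k} {m′} p (p^k∣m*n⇒p^k∣m k p∤n p^k∣m′n))
    where
    p^k∣m′n : p ^ k ∣ m′ * n
    p^k∣m′n = *-cancelʳ-∣ p (subst₂ _∣_ (ℕP.*-comm p (p ^ k)) (xy∙z≈xz∙y m′ p n) p^[1+k]∣mn)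

  InPowZp-/ : ∀ k a b .{{_ : NonZero b}} → p ^ k ∣ ℤ.∣ a ∣ → p ∤ b → InPowZp p k (a / b)
  InPowZp-/ k a b p^k∣a p∤b =
      p^k∣m*n⇒p^k∣m k p∤g (subst (p ^ k ∣_) (sym ∣↥a/b∣*g≡∣a∣) p^k∣a)
    , λ p∣↧ → p∤b (∣-trans p∣↧ (subst (↧ₙ (a / b) ∣_) ↧ₙa/b*g≡b (m∣m*n g)))
    where
    g : ℕ
    g = gcd ℤ.∣ a ∣ b
    ∣↥a/b∣*g≡∣a∣ : ℤ.∣ ↥ (a / b) ∣ * g ≡ ℤ.∣ a ∣
    ∣↥a/b∣*g≡∣a∣ = trans (sym (ℤP.abs-* (↥ (a / b)) (+ g))) (cong ℤ.∣_∣ (ℚP.↥-/ a b))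
    ↧ₙa/b*g≡b : ↧ₙ (a / b) * g ≡ b
    ↧ₙa/b*g≡b = ℤP.+-injective (trans (ℤP.pos-* (↧ₙ (a / b)) g) (ℚP.↧-/ a b))
    p∤g : p ∤ g
    p∤g p∣g = p∤b (∣-trans p∣g (gcd[m,n]∣n ℤ.∣ a ∣ b))

  module _ (k : ℕ) where

    private instance
      p^k≢0 : NonZero (p ^ k)
      p^k≢0 = ℕP.m^n≢0 p k

    open Mod (p ^ k)

    InPowZp-/-minus-/ : ∀ {a b a′ b′} .{{_ : NonZero b}} .{{_ : NonZero b′}} →
                        a ≈ a′ → b ≈ b′ → p ∤ b → p ∤ b′ → InPowZp p k (+ a / b - + a′ / b′)
    InPowZp-/-minus-/ {a} {b} {a′} {b′} a≈a′ b≈b′ p∤b p∤b′ =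
      subst (InPowZp p k) (sym (/-minus-/ (+ a) b (+ a′) b′))
        (InPowZp-/ k (+ a ℤ.* + b′ ℤ.- + a′ ℤ.* + b) (b * b′)
          (subst (λ z → p ^ k ∣ ℤ.∣ z ∣) numerator≡ (≈⇒∣∣-∣ (*-cong a≈a′ (sym b≈b′))))
          (∤-* p∤b p∤b′))
      where
      instance
        b*b′≢0 : NonZero (b * b′)
        b*b′≢0 = ℕP.m*n≢0 b b′
      numerator≡ : + (a * b′) ℤ.- + (a′ * b) ≡ + a ℤ.* + b′ ℤ.- + a′ ℤ.* + b
      numerator≡ = cong₂ ℤ._-_ (ℤP.pos-* a b′) (ℤP.pos-* a′ b)

lemma7 : (p : ℕ) → Prime p → (d k : ℕ) → 1 ≤ d → 1 ≤ k →
    (N : Fin k → Fin d → ℕ) → (s : ℕ) → (v u n : Fin d → ℕ) →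
    (∀ i → v i < p) → (∀ i → u i < p ^ s) →
    InPowZp p (suc s)
    ((BN N (λ i → v i + p * u i + p ^ suc s * n i)
    // BN N (λ i → p * u i + p ^ suc s * n i))
    - (BN N (λ i → v i + p * u i) // BN N (λ i → p * u i)))
lemma7 p p-prime d k _ _ N s v u n v<p _ =
  subst₂ (λ x y → InPowZp p (suc s) (x - y))
    (sym (BN-quot N (λ i → ℕP.+-assoc (v i) (p * u i) (q * n i)))) (sym (BN-quot N (λ _ → refl)))
    (InPowZp-/-minus-/ p-prime (suc s) {{quotDen-nonZero N v m}} {{quotDen-nonZero N v m′}}
      (quotNum-cong N v m≈m′) (quotDen-cong N v m≈m′)
      (∤-quotDen p-prime N v m p∣m v<p) (∤-quotDen p-prime N v m′ (λ i → m∣m*n (u i)) v<p))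
  where
  q : ℕ
  q = p ^ suc s
  m m′ : Fin d → ℕ
  m i = p * u i + q * n i
  m′ i = p * u i
  instance
    q≢0 : NonZero q
    q≢0 = ℕP.m^n≢0 p (suc s) {{prime⇒nonZero p-prime}}
  open Mod q
  m≈m′ : ∀ i → m i ≈ m′ i
  m≈m′ i = %-remove-+ʳ (p * u i) (m∣m*n (n i))
  p∣m : ∀ i → p ∣ m i
  p∣m i = ∣m∣n⇒∣m+n (m∣m*n (u i)) (∣-trans (m∣m*n (p ^ s)) (m∣m*n (n i)))
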